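{- Let $W$ be a recurrent infinite word, $S$ a Rauzy scheme for $W$ of scale $M$. For every collecting vertex of $S$, let $s$ be the natural right extension of the unique edge leaving that vertex. Then $F(s)$ is a left special factor of $W$ and ends with a bispecial factor of $W$ of length at least $M$.
   Context: A factor $u$ of an infinite word $W$ is right special if $ua,ub$ are factors of $W$ for two distinct letters $a,b$; left special if $au,bu$ are factors for two distinct letters; bispecial if both. $W$ recurrent: every factor occurs infinitely often. $u\sqsubseteq w$: factor; $u\sqsubseteq_k w$: at least $k$ occurrences. A graph with words is a strongly connected directed multigraph each edge $e$ of which carries a front word $F(e)$ and a back word $B(e)$, every vertex being distributing (in-degree $1$, out-degree $>1$) or collecting (in-degree $>1$, out-degree $1$). Paths are sequences of consecutive edges with edge records; a path is symmetric if its first edge starts at a collecting vertex and its last edge ends at a distributing vertex. For $s=v_1\dots v_n$: $F(s)$ = ordered concatenation of front words of $v_1$ and all $v_i$ starting at a distributing vertex; $B(s)$ = ordered concatenation of back words of all $v_i$ ending at a collecting vertex and of $v_n$. $S$ is a Rauzy scheme for $W$ if: (1) strongly connected, more than one edge; (2) front words of edges leaving one distributing vertex have pairwise distinct first letters, back words of edges entering one collecting vertex have pairwise distinct last letters; (3) $F(s)=B(s)$ for symmetric $s$; (4) for symmetric $s_1,s_2$, $F(s_1)\sqsubseteq_kF(s_2)$ implies the edge record of $s_1$ occurs at least $k$ times in that of $s_2$; (5) edge words are factors of $W$; (6) every factor of $W$ is a factor of $F(s)$ for some symmetric $s$; (7) for every edge $e$ there is a factor $u_e$ of $W$ such that every symmetric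 $s$ with $u_e\sqsubseteq F(s)$ passes through $e$. A support edge is an edge from a collecting to a distributing vertex; the scale of $S$ is the smallest length of words on support edges. The natural right extension of a path $s$ is the minimal path beginning with $s$ and ending at a distributing vertex. -}

module Defs where

open import Data.Nat using (ℕ; zero; suc; _+_; _≤_; _<_)
import Data.Nat as ℕ
open import Data.Fin using (Fin)
import Data.Fin as Fin
open import Data.List using (List; []; _∷_; _++_; length; map; upTo; filter; concatMap; _∷ʳ_)
open import Data.List.Membership.Propositional using (_∈_)
open import Data.List.NonEmpty using (List⁺; _∷_; head; last; toList)
open import Data.Fin.Base using ()
open import Data.List.Base using ()
open import Data.Bool using (Bool; if_then_else_)
open import Data.Product using (Σ; ∃; ∃-syntax; _×_; _,_)
open import Data.Sum using (_⊎_)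
open import Relation.Binary.PropositionalEquality using (_≡_; _≢_)
open import Relation.Nullary using (Dec; ¬_)
open import Relation.Nullary.Decidable using (⌊_⌋; _×-dec_)
open import Function.Definitions using (Injective)

InfWord : Set → Set
InfWord A = ℕ → A

window : {A : Set} → InfWord A → ℕ → ℕ → List A
window W i n = map (λ j → W (i + j)) (upTo n)

OccursAt : {A : Set} → List A → InfWord A → ℕ → Set
OccursAt u W i = window W i (length u) ≡ u

Factor : {A : Set} → List A → InfWord A → Set
Factor u W = ∃[ i ] OccursAt u W i

Recurrent : {A : Set} → InfWord A → Set
Recurrent W = ∀ u → Factor u W → ∀ n → ∃[ i ] (n ≤ i × OccursAt u W i)

LeftSpecial : {A : Set} → List A → InfWord A → Set
LeftSpecial u W = ∃[ a ] ∃[ b ] (a ≢ b × Factor (a ∷ u) W × Factor (b ∷ u) W)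

RightSpecial : {A : Set} → List A → InfWord A → Set
RightSpecial u W = ∃[ a ] ∃[ b ] (a ≢ b × Factor (u ∷ʳ a) W × Factor (u ∷ʳ b) W)

Bispecial : {A : Set} → List A → InfWord A → Set
Bispecial u W = LeftSpecial u W × RightSpecial u W

_⊑_ : {A : Set} → List A → List A → Set
u ⊑ w = ∃[ p ] ∃[ q ] (w ≡ p ++ u ++ q)

OccAtFin : {A : Set} → List A → List A → ℕ → Set
OccAtFin u w i = ∃[ p ] ∃[ q ] (w ≡ p ++ u ++ q × length p ≡ i)

_⊑[_]_ : {A : Set} → List A → ℕ → List A → Set
u ⊑[ k ] w = Σ (Fin k → ℕ) λ f → Injective _≡_ _≡_ f × (∀ j → OccAtFin u w (f j))

EndsWith : {A : Set} → List A → List A → Set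
EndsWith w v = ∃[ p ] (w ≡ p ++ v)

record GraphWithWords (A : Set) : Set where
  field
    nV nE : ℕ
    src tgt : Fin nE → Fin nV
    Fw : Fin nE → List A
    Bw : Fin nE → List A

module _ {A : Set} (G : GraphWithWords A) where
  open GraphWithWords G

  Edge : Set
  Edge = Fin nE

  Vertex : Set
  Vertex = Fin nV

  indeg : Vertex → ℕ
  indeg v = length (filter (λ e → tgt e Fin.≟ v) (Data.List.allFin nE))
    where import Data.List

  outdeg : Vertex → ℕ
  outdeg v = length (filter (λ e → src e Fin.≟ v) (Data.List.allFin nE))
    where import Data.List

  Distributing : Vertex → Set
  Distributing v = indeg v ≡ 1 × 1 < outdeg v

  Collecting : Vertex → Set
  Collecting v = 1 < indeg v × outdeg v ≡ 1

  isDist : Vertex → Bool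
  isDist v = ⌊ (indeg v ℕ.≟ 1) ×-dec (2 ℕ.≤? outdeg v) ⌋

  isColl : Vertex → Bool
  isColl v = ⌊ (2 ℕ.≤? indeg v) ×-dec (outdeg v ℕ.≟ 1) ⌋

  Consecutive : Edge → List Edge → Set
  Consecutive e [] = Data.Unit.⊤
    where import Data.Unit
  Consecutive e (e' ∷ r) = tgt e ≡ src e' × Consecutive e' r

  IsPath : List⁺ Edge → Set
  IsPath (e ∷ r) = Consecutive e r

  start end : List⁺ Edge → Vertex
  start s = src (head s)
  end s = tgt (last s)

  Symmetric : List⁺ Edge → Set
  Symmetric s = IsPath s × Collecting (start s) × Distributing (end s)

  Fp : List⁺ Edge → List A
  Fp (e ∷ r) = Fw e ++ concatMap (λ e' → if isDist (src e') then Fw e' else []) r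

  Bl : Edge → List Edge → List A
  Bl e [] = Bw e
  Bl e (e' ∷ r) = (if isColl (tgt e) then Bw e else []) ++ Bl e' r

  Bp : List⁺ Edge → List A
  Bp (e ∷ r) = Bl e r

  IsGraphWithWords : Set
  IsGraphWithWords = ∀ v → Distributing v ⊎ Collecting v

  StronglyConnected : Set
  StronglyConnected = ∀ u v → ∃[ s ] (IsPath s × start s ≡ u × end s ≡ v)

  FirstLetter : List A → A → Set
  FirstLetter w a = ∃[ w' ] (w ≡ a ∷ w')

  LastLetter : List A → A → Set
  LastLetter w a = ∃[ w' ] (w ≡ w' ∷ʳ a)

  record IsRauzyScheme (W : InfWord A) : Set where
    field
      graphWithWords : IsGraphWithWords
      strongly-connected : StronglyConnected
      more-than-one-edge : 1 < nE
      front-distinct : ∀ e e' → e ≢ e' → src e ≡ src e' → Distributing (src e) →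
        ∃[ a ] ∃[ a' ] (FirstLetter (Fw e) a × FirstLetter (Fw e') a' × a ≢ a')
      back-distinct : ∀ e e' → e ≢ e' → tgt e ≡ tgt e' → Collecting (tgt e) →
        ∃[ a ] ∃[ a' ] (LastLetter (Bw e) a × LastLetter (Bw e') a' × a ≢ a')
      symmetric-FB : ∀ s → Symmetric s → Fp s ≡ Bp s
      occurrences : ∀ s₁ s₂ → Symmetric s₁ → Symmetric s₂ → ∀ k →
        Fp s₁ ⊑[ k ] Fp s₂ → toList s₁ ⊑[ k ] toList s₂
      edge-factors : ∀ e → Factor (Fw e) W × Factor (Bw e) W
      covers : ∀ u → Factor u W → ∃[ s ] (Symmetric s × u ⊑ Fp s)
      edge-witness : ∀ e → ∃[ u ] (Factor u W ×
        (∀ s → Symmetric s → u ⊑ Fp s → e ∈ toList s))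

  Support : Edge → Set
  Support e = Collecting (src e) × Distributing (tgt e)

  IsScale : ℕ → Set
  IsScale M =
    (∃[ e ] (Support e × (length (Fw e) ≡ M ⊎ length (Bw e) ≡ M))) ×
    (∀ e → Support e → M ≤ length (Fw e) × M ≤ length (Bw e))

  BeginsWith : List⁺ Edge → List⁺ Edge → Set
  BeginsWith s p = ∃[ r ] (toList s ≡ toList p ++ r)

  NaturalRightExt : List⁺ Edge → List⁺ Edge → Set
  NaturalRightExt p t =
    IsPath t × BeginsWith t p × Distributing (end t) ×
    (∀ t' → IsPath t' → BeginsWith t' p → Distributing (end t') →
       length (toList t) ≤ length (toList t'))

-- All intermediate vertices of s are collecting, so F(s) is the front word of its first edge, and as
-- s is symmetric, F(s) = B(s) ends with the back word of its last edge en, a support edge, hence of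
-- length at least M. Specialness comes from the distinct last (first) letters of the back (front)
-- words at collecting (distributing) vertices: every edge lies on a symmetric path whose front word
-- is a factor of W, and on such a path an edge entering src e is followed by e, so its back word is
-- followed by F(s), while an edge leaving tgt en is preceded by en. That path is found by prolonging
-- the witness u of condition (7) by the maximal edge-word length on both sides (recurrence),
-- covering the prolongation by a symmetric path (condition (6)), and cutting that path down to a
-- minimal cover of u, which lies inside the prolongation.

module Submission where

open import Defs
open import Data.Bool using (true; false; T; if_then_else_)
open import Data.Empty using (⊥-elim)
import Data.Fin as Fin
open import Data.List using (List; []; _∷_; _++_; _∷ʳ_; [_]; length; map; upTo; applyUpTo; filter; concatMap; allFin; initLast; _∷ʳ′_)
open import Data.List.Properties using (length-map; length-upTo; ∷-injective; ++-assoc; ++-identityʳ; length-++; length-++-≤ˡ; map-upTo; map-cong; concatMap-++)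
open import Data.List.Membership.Propositional using (_∈_)
open import Data.List.Membership.Propositional.Properties using (∈-filter⁺; ∈-filter⁻; ∈-allFin; ∈-∃++)
open import Data.List.NonEmpty using (_∷_; last)
open import Data.List.Relation.Unary.All using (All; []; _∷_)
import Data.List.Relation.Unary.All as All
open import Data.List.Relation.Unary.Any using (here; there)
open import Data.List.Relation.Unary.Unique.Propositional using (Unique; _∷_)
open import Data.List.Relation.Unary.Unique.Propositional.Properties using (filter⁺; allFin⁺)
open import Data.Nat using (ℕ; zero; suc; _+_; _∸_; _≤_; _<_; s≤s; z≤n)
import Data.Nat as ℕ
open import Data.Nat.ListAction using (sum)
open import Data.Nat.Properties
open import Data.Product using (∃-syntax; _×_; _,_; proj₁; proj₂)
open import Data.Sum using (_⊎_; inj₁; inj₂)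
open import Data.Unit using (tt)
open import Function using (_∘_)
open import Relation.Binary.PropositionalEquality using (_≡_; _≢_; refl; sym; trans; cong; cong₂; subst; module ≡-Reasoning)
open import Relation.Nullary using (Dec; yes; no; ¬_)
open import Relation.Nullary.Decidable using (_×-dec_; dec-true; dec-false; isYes≗does; toWitness)

module _ {X : Set} where

  last⁺ : X → List X → X
  last⁺ x []       = x
  last⁺ _ (y ∷ ys) = last⁺ y ys

  last⁺-∷ʳ : ∀ x ys y → last⁺ x (ys ∷ʳ y) ≡ y
  last⁺-∷ʳ x []       y = refl
  last⁺-∷ʳ _ (z ∷ ys) y = last⁺-∷ʳ z ys y

  last≡last⁺ : ∀ x ys → last (x ∷ ys) ≡ last⁺ x ys
  last≡last⁺ x ys with initLast ys
  ... | []       = refl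
  ... | zs ∷ʳ′ y = sym (last⁺-∷ʳ x zs y)

  last⁺-++-∷ : ∀ x ys z zs → last⁺ x (ys ++ z ∷ zs) ≡ last⁺ z zs
  last⁺-++-∷ x []       z zs = refl
  last⁺-++-∷ _ (y ∷ ys) z zs = last⁺-++-∷ y ys z zs

  All-last⁺ : ∀ {P : X → Set} {x ys} → All P (x ∷ ys) → P (last⁺ x ys)
  All-last⁺ {ys = []}     (px ∷ [])  = px
  All-last⁺ {ys = _ ∷ _} (_ ∷ pys) = All-last⁺ pys

  ∈-last⁺-or-followed : ∀ {x} y ys → x ∈ y ∷ ys →
    last⁺ y ys ≡ x ⊎ ∃[ γ ] ∃[ h ] ∃[ δ ] (ys ≡ γ ++ h ∷ δ × last⁺ y γ ≡ x)
  ∈-last⁺-or-followed y []       (here refl) = inj₁ refl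
  ∈-last⁺-or-followed y (h ∷ δ)  (here refl) = inj₂ ([] , h , δ , refl , refl)
  ∈-last⁺-or-followed y (z ∷ zs) (there x∈) with ∈-last⁺-or-followed z zs x∈
  ... | inj₁ eq                        = inj₁ eq
  ... | inj₂ (γ , h , δ , refl , eq) = inj₂ (z ∷ γ , h , δ , refl , eq)

  length-++-∷ : ∀ (γ : List X) h δ → length (γ ++ h ∷ δ) ≡ suc (length γ + length δ)
  length-++-∷ γ h δ = trans (length-++ γ) (+-suc (length γ) (length δ))

  length-++-++ : ∀ (q u q′ : List X) {L} → length q ≡ L → length q′ ≡ L → length (q ++ u ++ q′) ≡ L + (length u + L)
  length-++-++ q u q′ |q| |q′| = trans (length-++ q) (cong₂ _+_ |q| (trans (length-++ u) (cong (length u +_) |q′|)))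

  applyUpTo-+ : ∀ (f : ℕ → X) m n → applyUpTo f (m + n) ≡ applyUpTo f m ++ applyUpTo (f ∘ (m +_)) n
  applyUpTo-+ f zero    n = refl
  applyUpTo-+ f (suc m) n = cong (f 0 ∷_) (applyUpTo-+ (f ∘ suc) m n)

  sum-map-≤ : (f : X → ℕ) {x : X} {xs : List X} → x ∈ xs → f x ≤ sum (map f xs)
  sum-map-≤ f {xs = y ∷ _} (here refl) = m≤m+n (f y) _
  sum-map-≤ f {xs = y ∷ _} (there x∈) = ≤-trans (sum-map-≤ f x∈) (m≤n+m _ (f y))

  ++-split : ∀ (as bs cs ds : List X) → as ++ bs ≡ cs ++ ds → length as ≤ length cs →
    ∃[ ms ] (cs ≡ as ++ ms × bs ≡ ms ++ ds)
  ++-split []       bs cs       ds eq _         = cs , refl , eq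
  ++-split (a ∷ as) bs (c ∷ cs) ds eq (s≤s le) with ∷-injective eq
  ... | refl , eq′ with ++-split as bs cs ds eq′ le
  ...   | ms , refl , eq″ = ms , refl , eq″

  ++-injective-length : ∀ (as bs cs ds : List X) → as ++ bs ≡ cs ++ ds → length as ≡ length cs →
    as ≡ cs × bs ≡ ds
  ++-injective-length []       bs []       ds eq _  = refl , eq
  ++-injective-length (a ∷ as) bs (c ∷ cs) ds eq le with ∷-injective eq
  ... | refl , eq′ with ++-injective-length as bs cs ds eq′ (suc-injective le)
  ...   | refl , eq″ = refl , eq″

  infix-of-overlap : ∀ (L P z Q K y R : List X) → L ≡ P ++ z ++ Q → L ≡ K ++ y ++ R →
    length P ≤ length K → length K + length y ≤ length P + length z → y ⊑ z
  infix-of-overlap L P z Q K y R eqz eqy P≤K y≤z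
    with ++-split P (z ++ Q) K (y ++ R) (trans (sym eqz) eqy) P≤K
  ... | K′ , refl , eq′
    with ++-split (K′ ++ y) R z Q (trans (++-assoc K′ y R) (sym eq′)) K′y≤z
    where
      K′y≤z : length (K′ ++ y) ≤ length z
      K′y≤z = +-cancelˡ-≤ (length P) _ _ (begin
        length P + length (K′ ++ y)    ≡⟨ cong (length P +_) (length-++ K′) ⟩
        length P + (length K′ + length y) ≡⟨ +-assoc (length P) _ _ ⟨
        length P + length K′ + length y ≡⟨ cong (_+ length y) (length-++ P) ⟨
        length (P ++ K′) + length y    ≤⟨ y≤z ⟩
        length P + length z            ∎)
        where open ≤-Reasoning
  ...   | M , eqM , _ = K′ , M , trans eqM (++-assoc K′ y M)

  length≡1⇒∈-unique : ∀ {xs : List X} → length xs ≡ 1 → ∀ {x y} → x ∈ xs → y ∈ xs → x ≡ y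
  length≡1⇒∈-unique {_ ∷ []} _ (here refl) (here refl) = refl

  Unique⇒two-distinct : ∀ {xs : List X} → Unique xs → 1 < length xs →
    ∃[ x ] ∃[ y ] (x ≢ y × x ∈ xs × y ∈ xs)
  Unique⇒two-distinct {x ∷ y ∷ _} ((x≢y ∷ _) ∷ _) _ = x , y , x≢y , here refl , there (here refl)
  Unique⇒two-distinct {_ ∷ []}    _ (s≤s ())

  first-split : (P : List X → X → List X → Set) → (∀ γ h δ → Dec (P γ h δ)) → ∀ xs →
    ∃[ γ ] ∃[ h ] ∃[ δ ] (xs ≡ γ ++ h ∷ δ × P γ h δ) ⊎ (∀ γ h δ → xs ≡ γ ++ h ∷ δ → ¬ P γ h δ)
  first-split P P? []       = inj₂ λ { [] _ _ () ; (_ ∷ _) _ _ () }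
  first-split P P? (x ∷ xs) with P? [] x xs
  ... | yes p = inj₁ ([] , x , xs , refl , p)
  ... | no ¬p with first-split (P ∘ (x ∷_)) (P? ∘ (x ∷_)) xs
  ...   | inj₁ (γ , h , δ , refl , p) = inj₁ (x ∷ γ , h , δ , refl , p)
  ...   | inj₂ none = inj₂ λ { [] _ _ refl → ¬p ; (_ ∷ γ) h δ refl → none γ h δ refl }

module _ {X : Set} (W : InfWord X) where

  window-length : ∀ i n → length (window W i n) ≡ n
  window-length i n = trans (length-map _ (upTo n)) (length-upTo n)

  window-+ : ∀ i m n → window W i (m + n) ≡ window W i m ++ window W (i + m) n
  window-+ i m n = begin
    window W i (m + n)                                                    ≡⟨ map-upTo _ (m + n) ⟩
    applyUpTo (λ j → W (i + j)) (m + n)                                   ≡⟨ applyUpTo-+ _ m n ⟩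
    applyUpTo (λ j → W (i + j)) m ++ applyUpTo (λ j → W (i + (m + j))) n  ≡⟨ cong₂ _++_ (map-upTo _ m) shift ⟨
    window W i m ++ window W (i + m) n                                    ∎
    where
      open ≡-Reasoning
      shift : window W (i + m) n ≡ applyUpTo (λ j → W (i + (m + j))) n
      shift = trans (map-cong (λ j → cong W (+-assoc i m j)) (upTo n)) (map-upTo _ n)

  window-occurs : ∀ i n → OccursAt (window W i n) W i
  window-occurs i n = cong (window W i) (window-length i n)

  occursAt-++⁺ : ∀ {u v i} → OccursAt u W i → OccursAt v W (i + length u) → OccursAt (u ++ v) W i
  occursAt-++⁺ {u} {v} {i} occ-u occ-v = begin
    window W i (length (u ++ v))                         ≡⟨ cong (window W i) (length-++ u) ⟩
    window W i (length u + length v)                     ≡⟨ window-+ i (length u) (length v) ⟩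
    window W i (length u) ++ window W (i + length u) (length v) ≡⟨ cong₂ _++_ occ-u occ-v ⟩
    u ++ v                                               ∎
    where open ≡-Reasoning

  occursAt-++⁻ : ∀ {u v i} → OccursAt (u ++ v) W i → OccursAt u W i × OccursAt v W (i + length u)
  occursAt-++⁻ {u} {v} {i} occ = ++-injective-length _ _ u v split (window-length i (length u))
    where
      split : window W i (length u) ++ window W (i + length u) (length v) ≡ u ++ v
      split = trans (sym (window-+ i (length u) (length v)))
                    (trans (cong (window W i) (sym (length-++ u))) occ)

  factor-⊑ : ∀ {y z} → y ⊑ z → Factor z W → Factor y W
  factor-⊑ {y} (p , q , refl) (i , occ) =
    i + length p , proj₁ (occursAt-++⁻ (proj₂ (occursAt-++⁻ {p} occ)))

  factor-extend : Recurrent W → ∀ {u} → Factor u W → ∀ L →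
    ∃[ q ] ∃[ q′ ] (length q ≡ L × length q′ ≡ L × Factor (q ++ u ++ q′) W)
  factor-extend rec {u} fu L with rec u fu L
  ... | i , L≤i , occ-u =
    window W (i ∸ L) L , window W (i + length u) L , window-length (i ∸ L) L , window-length (i + length u) L ,
    i ∸ L , occursAt-++⁺ (window-occurs (i ∸ L) L) occ-u++q′
    where
      occ-u++q′ : OccursAt (u ++ window W (i + length u) L) W (i ∸ L + length (window W (i ∸ L) L))
      occ-u++q′ rewrite window-length (i ∸ L) L | m∸n+n≡m L≤i =
        occursAt-++⁺ occ-u (window-occurs (i + length u) L)

module Graph {A : Set} (S : GraphWithWords A) where
  open GraphWithWords S

  src-unique : ∀ {v} → outdeg S v ≡ 1 → ∀ {e e′} → src e ≡ v → src e′ ≡ v → e ≡ e′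
  src-unique d {e} {e′} p p′ = length≡1⇒∈-unique d
    (∈-filter⁺ (λ e → src e Fin.≟ _) (∈-allFin e) p) (∈-filter⁺ (λ e → src e Fin.≟ _) (∈-allFin e′) p′)

  tgt-unique : ∀ {v} → indeg S v ≡ 1 → ∀ {e e′} → tgt e ≡ v → tgt e′ ≡ v → e ≡ e′
  tgt-unique d {e} {e′} p p′ = length≡1⇒∈-unique d
    (∈-filter⁺ (λ e → tgt e Fin.≟ _) (∈-allFin e) p) (∈-filter⁺ (λ e → tgt e Fin.≟ _) (∈-allFin e′) p′)

  two-out-edges : ∀ {v} → 1 < outdeg S v → ∃[ e ] ∃[ e′ ] (e ≢ e′ × src e ≡ v × src e′ ≡ v)
  two-out-edges {v} lt with Unique⇒two-distinct (filter⁺ (λ e → src e Fin.≟ v) (allFin⁺ nE)) lt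
  ... | e , e′ , e≢e′ , e∈ , e′∈ =
    e , e′ , e≢e′ , proj₂ (∈-filter⁻ (λ e → src e Fin.≟ v) {xs = allFin nE} e∈) ,
                    proj₂ (∈-filter⁻ (λ e → src e Fin.≟ v) {xs = allFin nE} e′∈)

  two-in-edges : ∀ {v} → 1 < indeg S v → ∃[ e ] ∃[ e′ ] (e ≢ e′ × tgt e ≡ v × tgt e′ ≡ v)
  two-in-edges {v} lt with Unique⇒two-distinct (filter⁺ (λ e → tgt e Fin.≟ v) (allFin⁺ nE)) lt
  ... | e , e′ , e≢e′ , e∈ , e′∈ =
    e , e′ , e≢e′ , proj₂ (∈-filter⁻ (λ e → tgt e Fin.≟ v) {xs = allFin nE} e∈) ,
                    proj₂ (∈-filter⁻ (λ e → tgt e Fin.≟ v) {xs = allFin nE} e′∈)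

  distributing? : ∀ v → Dec (Distributing S v)
  distributing? v = (indeg S v ℕ.≟ 1) ×-dec (2 ℕ.≤? outdeg S v)

  collecting? : ∀ v → Dec (Collecting S v)
  collecting? v = (2 ℕ.≤? indeg S v) ×-dec (outdeg S v ℕ.≟ 1)

  collecting⇒¬distributing : ∀ {v} → Collecting S v → ¬ Distributing S v
  collecting⇒¬distributing (1<indeg , _) (indeg≡1 , _) = <-irrefl (sym indeg≡1) 1<indeg

  isDist-true : ∀ {v} → Distributing S v → isDist S v ≡ true
  isDist-true {v} d = trans (isYes≗does (distributing? v)) (dec-true (distributing? v) d)

  isDist-false : ∀ {v} → Collecting S v → isDist S v ≡ false
  isDist-false {v} c = trans (isYes≗does (distributing? v)) (dec-false (distributing? v) (collecting⇒¬distributing c))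

  isColl-true : ∀ {v} → Collecting S v → isColl S v ≡ true
  isColl-true {v} c = trans (isYes≗does (collecting? v)) (dec-true (collecting? v) c)

  isDist-true⁻ : ∀ {v} → isDist S v ≡ true → Distributing S v
  isDist-true⁻ {v} eq = toWitness {a? = distributing? v} (subst T (sym eq) tt)

  isColl-true⁻ : ∀ {v} → isColl S v ≡ true → Collecting S v
  isColl-true⁻ {v} eq = toWitness {a? = collecting? v} (subst T (sym eq) tt)

  front : Edge S → List A
  front e = if isDist S (src e) then Fw e else []

  fronts : List (Edge S) → List A
  fronts = concatMap front

  front-dist : ∀ {e} → Distributing S (src e) → front e ≡ Fw e
  front-dist {e} d = cong (if_then Fw e else []) (isDist-true d)

  front-coll : ∀ {e} → Collecting S (src e) → front e ≡ []
  front-coll {e} c = cong (if_then Fw e else []) (isDist-false c)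

  fronts-coll : ∀ {r} → All (Collecting S ∘ src) r → fronts r ≡ []
  fronts-coll []                    = refl
  fronts-coll {e ∷ _} (c ∷ cs) = cong₂ _++_ (front-coll c) (fronts-coll cs)

  Fp-++ : ∀ g r₁ r₂ → Fp S (g ∷ (r₁ ++ r₂)) ≡ Fp S (g ∷ r₁) ++ fronts r₂
  Fp-++ g r₁ r₂ = trans (cong (Fw g ++_) (concatMap-++ front r₁ r₂)) (sym (++-assoc (Fw g) (fronts r₁) (fronts r₂)))

  fronts-last-split : ∀ r → fronts r ≡ [] ⊎
    ∃[ ρ ] ∃[ h ] ∃[ δ ] (r ≡ ρ ++ h ∷ δ × Distributing S (src h) × fronts r ≡ fronts ρ ++ Fw h)
  fronts-last-split [] = inj₁ refl
  fronts-last-split (e ∷ r) with fronts-last-split r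
  ... | inj₂ (ρ , h , δ , refl , d , eq) =
    inj₂ (e ∷ ρ , h , δ , refl , d , trans (cong (front e ++_) eq) (sym (++-assoc (front e) (fronts ρ) (Fw h))))
  ... | inj₁ eq with isDist S (src e) in d
  ...   | true  = inj₂ ([] , e , r , refl , isDist-true⁻ d , trans (cong (Fw e ++_) eq) (++-identityʳ (Fw e)))
  ...   | false = inj₁ eq

  Consecutive-++⁻ : ∀ g γ h δ → Consecutive S g (γ ++ h ∷ δ) →
    Consecutive S g γ × tgt (last⁺ g γ) ≡ src h × Consecutive S h δ
  Consecutive-++⁻ g []      h δ (p , c) = tt , p , c
  Consecutive-++⁻ g (x ∷ γ) h δ (p , c) with Consecutive-++⁻ x γ h δ c
  ... | cγ , q , cδ = (p , cγ) , q , cδ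

  Consecutive-++⁺ : ∀ g γ h δ → Consecutive S g γ → tgt (last⁺ g γ) ≡ src h → Consecutive S h δ →
    Consecutive S g (γ ++ h ∷ δ)
  Consecutive-++⁺ g []      h δ _        q cδ = q , cδ
  Consecutive-++⁺ g (x ∷ γ) h δ (p , cγ) q cδ = p , Consecutive-++⁺ x γ h δ cγ q cδ

  back : Edge S → List A
  back e = if isColl S (tgt e) then Bw e else []

  Bl-++ : ∀ g γ h δ → Collecting S (tgt (last⁺ g γ)) → Bl S g (γ ++ h ∷ δ) ≡ Bl S g γ ++ Bl S h δ
  Bl-++ g []      h δ c rewrite isColl-true c = refl
  Bl-++ g (x ∷ γ) h δ c =
    trans (cong (back g ++_) (Bl-++ x γ h δ c)) (sym (++-assoc (back g) (Bl S x γ) (Bl S h δ)))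

  Bl-last : ∀ g r → ∃[ Z ] (Bl S g r ≡ Z ++ Bw (last⁺ g r))
  Bl-last g []      = [] , refl
  Bl-last g (x ∷ r) with Bl-last x r
  ... | Z , eq = back g ++ Z , trans (cong (back g ++_) eq) (sym (++-assoc (back g) Z _))

  Bl-first-split : ∀ g r → Bl S g r ≡ Bw (last⁺ g r) ⊎
    ∃[ γ ] ∃[ h ] ∃[ δ ] (r ≡ γ ++ h ∷ δ × Collecting S (tgt (last⁺ g γ)) × Bl S g γ ≡ Bw (last⁺ g γ))
  Bl-first-split g [] = inj₁ refl
  Bl-first-split g (h ∷ r) with isColl S (tgt g) in c
  ... | true  = inj₂ ([] , h , r , refl , isColl-true⁻ c , refl)
  ... | false with Bl-first-split h r
  ...   | inj₁ eq                             = inj₁ eq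
  ...   | inj₂ (γ , h′ , δ , refl , c′ , eq) = inj₂ (h ∷ γ , h′ , δ , refl , c′ ,
                                            trans (cong (λ b → (if b then Bw g else []) ++ Bl S h γ) c) eq)

  -- A distributing intermediate vertex would end a shorter extension.
  naturalRightExt-collecting : IsGraphWithWords S → ∀ {e s} → NaturalRightExt S (e ∷ []) (e ∷ s) →
    All (Collecting S ∘ src) s
  naturalRightExt-collecting dist-or-coll {e} {s} (path , _ , _ , minimal) = All.tabulate collecting
    where
      collecting : ∀ {h} → h ∈ s → Collecting S (src h)
      collecting {h} h∈s with ∈-∃++ h∈s
      ... | γ , δ , refl with Consecutive-++⁻ e γ h δ path | dist-or-coll (src h)
      ...   | _     , _ , _ | inj₂ c = c
      ...   | cons-γ , q , _ | inj₁ d = ⊥-elim (m+1+n≰m (length γ) (≤-trans (≤-reflexive (sym (length-++ γ))) (≤-pred shorter)))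
        where
          shorter : length (e ∷ γ ++ h ∷ δ) ≤ length (e ∷ γ)
          shorter = minimal (e ∷ γ) cons-γ (γ , refl)
            (subst (Distributing S) (sym (trans (cong tgt (last≡last⁺ e γ)) q)) d)

module Scheme {A : Set} {W : InfWord A} {S : GraphWithWords A} (RS : IsRauzyScheme S W) where
  open GraphWithWords S
  open Graph S
  open IsRauzyScheme RS

  Sym : Edge S → List (Edge S) → Set
  Sym g r = Symmetric S (g ∷ r)

  sym-intro : ∀ {g r} → Consecutive S g r → Collecting S (src g) → Distributing S (tgt (last⁺ g r)) → Sym g r
  sym-intro {g} {r} cons c d = cons , c , subst (Distributing S) (cong tgt (sym (last≡last⁺ g r))) d

  sym-end : ∀ {g r} → Sym g r → Distributing S (tgt (last⁺ g r))
  sym-end {g} {r} (_ , _ , d) = subst (Distributing S) (cong tgt (last≡last⁺ g r)) d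

  F≡B : ∀ {g r} → Sym g r → Fp S (g ∷ r) ≡ Bl S g r
  F≡B = symmetric-FB _

  F-endsWith-Bw-last : ∀ {g r} → Sym g r → EndsWith (Fp S (g ∷ r)) (Bw (last⁺ g r))
  F-endsWith-Bw-last {g} {r} sy with Bl-last g r
  ... | Z , eq = Z , trans (F≡B sy) eq

  cut-at-collecting : ∀ {g γ h δ} → Sym g (γ ++ h ∷ δ) → Collecting S (src h) →
    Sym h δ × Fp S (g ∷ (γ ++ h ∷ δ)) ≡ Bl S g γ ++ Fp S (h ∷ δ)
  cut-at-collecting {g} {γ} {h} {δ} sy@(cons , _ , _) ch = sy-h , (begin
    Fp S (g ∷ (γ ++ h ∷ δ)) ≡⟨ F≡B sy ⟩
    Bl S g (γ ++ h ∷ δ)     ≡⟨ Bl-++ g γ h δ (subst (Collecting S) (sym q) ch) ⟩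
    Bl S g γ ++ Bl S h δ    ≡⟨ cong (Bl S g γ ++_) (F≡B sy-h) ⟨
    Bl S g γ ++ Fp S (h ∷ δ) ∎)
    where
      open ≡-Reasoning
      split = Consecutive-++⁻ g γ h δ cons
      q = proj₁ (proj₂ split)
      sy-h : Sym h δ
      sy-h = sym-intro (proj₂ (proj₂ split)) ch (subst (Distributing S) (cong tgt (last⁺-++-∷ g γ h δ)) (sym-end sy))

  cut-at-distributing : ∀ {g γ h δ} → Sym g (γ ++ h ∷ δ) → Distributing S (src h) → Sym g γ
  cut-at-distributing {g} {γ} {h} {δ} (cons , cg , _) dh with Consecutive-++⁻ g γ h δ cons
  ... | cons-γ , q , _ = sym-intro cons-γ cg (subst (Distributing S) (sym q) dh)

  wordBound : ℕ
  wordBound = sum (map (λ e → length (Fw e) + length (Bw e)) (allFin nE))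

  Fw≤wordBound : ∀ e → length (Fw e) ≤ wordBound
  Fw≤wordBound e = ≤-trans (m≤m+n _ _) (sum-map-≤ (λ e → length (Fw e) + length (Bw e)) (∈-allFin e))

  Bw≤wordBound : ∀ e → length (Bw e) ≤ wordBound
  Bw≤wordBound e = ≤-trans (m≤n+m _ _) (sum-map-≤ (λ e → length (Fw e) + length (Bw e)) (∈-allFin e))

  record MinimalCover (T : List A) (j n : ℕ) : Set where
    constructor mkCover
    field
      g             : Edge S
      r             : List (Edge S)
      symmetric     : Sym g r
      X Y           : List A
      T≡            : T ≡ X ++ Fp S (g ∷ r) ++ Y
      starts-before : length X ≤ j
      ends-after    : j + n ≤ length X + length (Fp S (g ∷ r))
      no-right-cut  : ∀ γ h δ → r ≡ γ ++ h ∷ δ → Distributing S (src h) →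
                      length X + length (Fp S (g ∷ γ)) < j + n
      no-left-cut   : ∀ γ h δ → r ≡ γ ++ h ∷ δ → Collecting S (src h) →
                      j < length X + length (Bl S g γ)

  -- Minimality keeps the cover within one edge word of the window on either side.
  cover-start : ∀ {T j n} (c : MinimalCover T j n) → j ≤ length (MinimalCover.X c) + wordBound
  cover-start {j = j} {n} (mkCover g r sy X Y _ _ ends-after _ no-left-cut) with Bl-first-split g r
  ... | inj₁ eq = ≤-trans (m≤m+n j n) (≤-trans ends-after (+-monoʳ-≤ (length X)
                    (≤-trans (≤-reflexive (cong length (trans (F≡B sy) eq))) (Bw≤wordBound _))))
  ... | inj₂ (γ , h , δ , refl , c , eq) = ≤-trans (<⇒≤ (no-left-cut γ h δ refl ch))
        (+-monoʳ-≤ (length X) (≤-trans (≤-reflexive (cong length eq)) (Bw≤wordBound _)))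
    where
      ch : Collecting S (src h)
      ch = subst (Collecting S) (proj₁ (proj₂ (Consecutive-++⁻ g γ h δ (proj₁ sy)))) c

  cover-end : ∀ {T j n} (c : MinimalCover T j n) →
    length (MinimalCover.X c) + length (Fp S (MinimalCover.g c ∷ MinimalCover.r c)) ≤ j + n + wordBound
  cover-end {j = j} {n} (mkCover g r _ X _ _ starts-before _ no-right-cut _) with fronts-last-split r
  ... | inj₁ eq = +-mono-≤ (≤-trans starts-before (m≤m+n j n))
        (≤-trans (≤-reflexive (cong length (trans (cong (Fw g ++_) eq) (++-identityʳ (Fw g))))) (Fw≤wordBound g))
  ... | inj₂ (ρ , h , δ , refl , dh , eq) = begin
    length X + length (Fw g ++ fronts (ρ ++ h ∷ δ))   ≡⟨ cong (λ w → length X + length w) F≡ ⟩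
    length X + length (Fp S (g ∷ ρ) ++ Fw h)         ≡⟨ cong (length X +_) (length-++ (Fp S (g ∷ ρ))) ⟩
    length X + (length (Fp S (g ∷ ρ)) + length (Fw h)) ≡⟨ +-assoc (length X) _ _ ⟨
    length X + length (Fp S (g ∷ ρ)) + length (Fw h) ≤⟨ +-mono-≤ (<⇒≤ (no-right-cut ρ h δ refl dh)) (Fw≤wordBound h) ⟩
    j + n + wordBound                                ∎
    where
      open ≤-Reasoning
      F≡ : Fw g ++ fronts (ρ ++ h ∷ δ) ≡ Fp S (g ∷ ρ) ++ Fw h
      F≡ = trans (cong (Fw g ++_) eq) (sym (++-assoc (Fw g) (fronts ρ) (Fw h)))

  shrink : ∀ {T j n} fuel g r → length r < fuel → Sym g r → ∀ X Y → T ≡ X ++ Fp S (g ∷ r) ++ Y →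
    length X ≤ j → j + n ≤ length X + length (Fp S (g ∷ r)) → MinimalCover T j n
  shrink {T} {j} {n} (suc fuel) g r r<fuel sy X Y T≡ start end
    with first-split (λ γ h δ → Distributing S (src h) × j + n ≤ length X + length (Fp S (g ∷ γ)))
                     (λ γ h δ → distributing? (src h) ×-dec (j + n ℕ.≤? length X + length (Fp S (g ∷ γ)))) r
  ... | inj₁ (γ , h , δ , refl , dh , end′) =
    shrink fuel g γ (<-≤-trans (≤-trans (s≤s (m≤m+n _ _)) (≤-reflexive (sym (length-++-∷ γ h δ)))) (≤-pred r<fuel))
      (cut-at-distributing sy dh) X (fronts (h ∷ δ) ++ Y) T≡′ start end′
    where
      T≡′ : T ≡ X ++ Fp S (g ∷ γ) ++ fronts (h ∷ δ) ++ Y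
      T≡′ = trans T≡ (cong (X ++_) (trans (cong (_++ Y) (Fp-++ g γ (h ∷ δ))) (++-assoc (Fp S (g ∷ γ)) _ Y)))
  ... | inj₂ no-right
    with first-split (λ γ h δ → Collecting S (src h) × length X + length (Bl S g γ) ≤ j)
                     (λ γ h δ → collecting? (src h) ×-dec (length X + length (Bl S g γ) ℕ.≤? j)) r
  ...   | inj₁ (γ , h , δ , refl , ch , start′) =
    shrink fuel h δ (<-≤-trans (≤-trans (s≤s (m≤n+m _ _)) (≤-reflexive (sym (length-++-∷ γ h δ)))) (≤-pred r<fuel))
      sy-h (X ++ Bl S g γ) Y T≡′ (≤-trans (≤-reflexive (length-++ X)) start′) end′
    where
      sy-h = proj₁ (cut-at-collecting sy ch)
      F≡ = proj₂ (cut-at-collecting sy ch)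
      T≡′ : T ≡ (X ++ Bl S g γ) ++ Fp S (h ∷ δ) ++ Y
      T≡′ = trans T≡ (trans (cong (λ w → X ++ w ++ Y) F≡)
              (trans (cong (X ++_) (++-assoc (Bl S g γ) _ Y)) (sym (++-assoc X (Bl S g γ) _))))
      end′ : j + n ≤ length (X ++ Bl S g γ) + length (Fp S (h ∷ δ))
      end′ = ≤-trans end (≤-reflexive (begin
        length X + length (Fp S (g ∷ (γ ++ h ∷ δ)))             ≡⟨ cong (λ w → length X + length w) F≡ ⟩
        length X + length (Bl S g γ ++ Fp S (h ∷ δ))             ≡⟨ cong (length X +_) (length-++ (Bl S g γ)) ⟩
        length X + (length (Bl S g γ) + length (Fp S (h ∷ δ)))   ≡⟨ +-assoc (length X) _ _ ⟨
        length X + length (Bl S g γ) + length (Fp S (h ∷ δ))     ≡⟨ cong (_+ length (Fp S (h ∷ δ))) (length-++ X) ⟨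
        length (X ++ Bl S g γ) + length (Fp S (h ∷ δ))           ∎))
        where open ≡-Reasoning
  ...   | inj₂ no-left = mkCover g r sy X Y T≡ start end
          (λ γ h δ eq dh → ≰⇒> (λ le → no-right γ h δ eq (dh , le)))
          (λ γ h δ eq ch → ≰⇒> (λ le → no-left γ h δ eq (ch , le)))

  minimalCover : ∀ {g r j n} → Sym g r → j + n ≤ length (Fp S (g ∷ r)) → MinimalCover (Fp S (g ∷ r)) j n
  minimalCover {g} {r} sy inside = shrink (suc (length r)) g r ≤-refl sy [] [] (sym (++-identityʳ _)) z≤n inside

  minimalCover-within : ∀ {g₀ r₀} → Sym g₀ r₀ → ∀ P q u q′ Q → Fp S (g₀ ∷ r₀) ≡ P ++ (q ++ u ++ q′) ++ Q →
    length q ≡ wordBound → length q′ ≡ wordBound →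
    ∃[ g ] ∃[ r ] (Sym g r × u ⊑ Fp S (g ∷ r) × Fp S (g ∷ r) ⊑ (q ++ u ++ q′))
  minimalCover-within {g₀} {r₀} sy₀ P q u q′ Q F₀≡ |q| |q′|
    with minimalCover {j = length P + wordBound} {n = length u} sy₀ inside
    where
      inside : length P + wordBound + length u ≤ length (Fp S (g₀ ∷ r₀))
      inside = begin
        length P + wordBound + length u         ≡⟨ +-assoc (length P) wordBound (length u) ⟩
        length P + (wordBound + length u)       ≤⟨ +-monoʳ-≤ (length P) (≤-trans (m≤m+n _ wordBound)
                                                     (≤-reflexive (trans (+-assoc wordBound _ wordBound)
                                                       (sym (length-++-++ q u q′ |q| |q′|))))) ⟩
        length P + length (q ++ u ++ q′)        ≤⟨ +-monoʳ-≤ (length P) (length-++-≤ˡ (q ++ u ++ q′)) ⟩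
        length P + length ((q ++ u ++ q′) ++ Q) ≡⟨ length-++ P ⟨
        length (P ++ (q ++ u ++ q′) ++ Q)       ≡⟨ cong length F₀≡ ⟨
        length (Fp S (g₀ ∷ r₀))                 ∎
        where open ≤-Reasoning
  ... | c@(mkCover g r sy X Y T≡ starts-before ends-after _ _) = g , r , sy , u⊑F , F⊑z
    where
      B = wordBound
      |P++q| : length (P ++ q) ≡ length P + B
      |P++q| = trans (length-++ P) (cong (length P +_) |q|)
      u-in-T : Fp S (g₀ ∷ r₀) ≡ (P ++ q) ++ u ++ (q′ ++ Q)
      u-in-T = trans F₀≡ (trans (cong (P ++_) (trans (++-assoc q _ Q) (cong (q ++_) (++-assoc u q′ Q))))
                 (sym (++-assoc P q _)))
      u⊑F : u ⊑ Fp S (g ∷ r)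
      u⊑F = infix-of-overlap (Fp S (g₀ ∷ r₀)) X (Fp S (g ∷ r)) Y (P ++ q) u (q′ ++ Q) T≡ u-in-T
              (≤-trans starts-before (≤-reflexive (sym |P++q|)))
              (≤-trans (≤-reflexive (cong (_+ length u) |P++q|)) ends-after)
      F⊑z : Fp S (g ∷ r) ⊑ (q ++ u ++ q′)
      F⊑z = infix-of-overlap (Fp S (g₀ ∷ r₀)) P (q ++ u ++ q′) Q X (Fp S (g ∷ r)) Y F₀≡ T≡
              (+-cancelʳ-≤ B (length P) (length X) (cover-start c))
              (≤-trans (cover-end c) (≤-reflexive (begin
                length P + B + length u + B      ≡⟨ +-assoc (length P + B) (length u) B ⟩
                length P + B + (length u + B)    ≡⟨ +-assoc (length P) B _ ⟩
                length P + (B + (length u + B))  ≡⟨ cong (length P +_) (length-++-++ q u q′ |q| |q′|) ⟨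
                length P + length (q ++ u ++ q′) ∎)))
        where open ≡-Reasoning

  symmetric-factor-through : Recurrent W → ∀ {u} → Factor u W →
    ∃[ g ] ∃[ r ] (Sym g r × u ⊑ Fp S (g ∷ r) × Factor (Fp S (g ∷ r)) W)
  symmetric-factor-through rec {u} fu =
    let q , q′ , |q| , |q′| , fz = factor-extend W rec fu wordBound
        g₀ ∷ r₀ , sy₀ , P , Q , F₀≡ = covers (q ++ u ++ q′) fz
        g , r , sy , u⊑F , F⊑z = minimalCover-within sy₀ P q u q′ Q F₀≡ |q| |q′|
    in g , r , sy , u⊑F , factor-⊑ W F⊑z fz

  -- Opaque so that the with-abstractions below do not unfold the localisation argument.
  opaque
    edge-on-symmetric-factor : Recurrent W → ∀ e →
      ∃[ g ] ∃[ r ] (Sym g r × e ∈ g ∷ r × Factor (Fp S (g ∷ r)) W)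
    edge-on-symmetric-factor rec e =
      let u , fu , forces = edge-witness e
          g , r , sy , u⊑F , fF = symmetric-factor-through rec fu
      in g , r , sy , forces (g ∷ r) sy u⊑F , fF

  -- e′ enters the collecting vertex src e, so on a symmetric path it is followed by e and B(e′)
  -- runs into F(e ∷ s).
  left-extension : Recurrent W → ∀ {e s} → Sym e s → All (Collecting S ∘ src) s →
    ∀ {e′ a} → tgt e′ ≡ src e → LastLetter S (Bw e′) a → Factor (a ∷ Fp S (e ∷ s)) W
  left-extension rec {e} {s} sy-e@(_ , ce , _) colls {e′} {a} e′→e (w , Bw≡) with edge-on-symmetric-factor rec e′
  ... | g , r , sy , e′∈ , fF with ∈-last⁺-or-followed g r e′∈
  ...   | inj₁ last≡e′ = ⊥-elim (collecting⇒¬distributing ce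
            (subst (Distributing S) (trans (cong tgt last≡e′) e′→e) (sym-end sy)))
  ...   | inj₂ (γ , h , δ , refl , last≡e′)
          with src-unique (proj₂ ce)
                 (trans (sym (proj₁ (proj₂ (Consecutive-++⁻ g γ h δ (proj₁ sy))))) (trans (cong tgt last≡e′) e′→e)) refl
  ...     | refl = factor-⊑ W (Z ++ w , fronts (e ∷ δ) , F≡) fF
    where
      cons = Consecutive-++⁻ g γ e δ (proj₁ sy)
      sy′ : Sym g (γ ++ e ∷ s)
      sy′ = sym-intro (Consecutive-++⁺ g γ e s (proj₁ cons) (proj₁ (proj₂ cons)) (proj₁ sy-e)) (proj₁ (proj₂ sy))
              (subst (Distributing S) (cong tgt (sym (last⁺-++-∷ g γ e s))) (sym-end sy-e))
      Z = proj₁ (Bl-last g γ)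
      Bl≡ : Bl S g γ ≡ (Z ++ w) ++ [ a ]
      Bl≡ = trans (proj₂ (Bl-last g γ))
              (trans (cong (λ x → Z ++ Bw x) last≡e′) (trans (cong (Z ++_) Bw≡) (sym (++-assoc Z w [ a ]))))
      open ≡-Reasoning
      Fγ≡ : Fp S (g ∷ γ) ≡ Bl S g γ ++ Fp S (e ∷ s)
      Fγ≡ = begin
        Fp S (g ∷ γ)                   ≡⟨ ++-identityʳ _ ⟨
        Fp S (g ∷ γ) ++ []             ≡⟨ cong (Fp S (g ∷ γ) ++_) (fronts-coll (ce ∷ colls)) ⟨
        Fp S (g ∷ γ) ++ fronts (e ∷ s) ≡⟨ Fp-++ g γ (e ∷ s) ⟨
        Fp S (g ∷ (γ ++ e ∷ s))        ≡⟨ proj₂ (cut-at-collecting sy′ ce) ⟩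
        Bl S g γ ++ Fp S (e ∷ s)       ∎
      F≡ : Fp S (g ∷ (γ ++ e ∷ δ)) ≡ (Z ++ w) ++ (a ∷ Fp S (e ∷ s)) ++ fronts (e ∷ δ)
      F≡ = begin
        Fp S (g ∷ (γ ++ e ∷ δ))                            ≡⟨ Fp-++ g γ (e ∷ δ) ⟩
        Fp S (g ∷ γ) ++ fronts (e ∷ δ)                     ≡⟨ cong (_++ fronts (e ∷ δ)) (trans Fγ≡ (cong (_++ Fp S (e ∷ s)) Bl≡)) ⟩
        (((Z ++ w) ++ [ a ]) ++ Fp S (e ∷ s)) ++ fronts (e ∷ δ) ≡⟨ ++-assoc ((Z ++ w) ++ [ a ]) _ _ ⟩
        ((Z ++ w) ++ [ a ]) ++ Fp S (e ∷ s) ++ fronts (e ∷ δ)  ≡⟨ ++-assoc (Z ++ w) [ a ] _ ⟩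
        (Z ++ w) ++ (a ∷ Fp S (e ∷ s)) ++ fronts (e ∷ δ)       ∎

  -- f leaves the distributing vertex tgt en, so on a symmetric path it is preceded by en and
  -- F(f) follows B(en).
  right-extension : Recurrent W → ∀ {en} → Support S en → ∀ {f b} → src f ≡ tgt en →
    FirstLetter S (Fw f) b → Factor (Bw en ∷ʳ b) W
  right-extension rec {en} (_ , d-en) {f} {b} en→f (w , Fw≡) with edge-on-symmetric-factor rec f
  ... | g , r , sy , here refl , _ =
        ⊥-elim (collecting⇒¬distributing (proj₁ (proj₂ sy)) (subst (Distributing S) (sym en→f) d-en))
  ... | g , r , sy , there f∈r , fF with ∈-∃++ f∈r
  ...   | γ , δ , refl
          with tgt-unique (proj₁ d-en) (trans (proj₁ (proj₂ (Consecutive-++⁻ g γ f δ (proj₁ sy)))) en→f) refl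
  ...     | refl = factor-⊑ W (Z , w ++ fronts δ , F≡) fF
    where
      d-f : Distributing S (src f)
      d-f = subst (Distributing S) (sym en→f) d-en
      ends = F-endsWith-Bw-last (cut-at-distributing sy d-f)
      Z = proj₁ ends
      open ≡-Reasoning
      F≡ : Fp S (g ∷ (γ ++ f ∷ δ)) ≡ Z ++ (Bw (last⁺ g γ) ∷ʳ b) ++ w ++ fronts δ
      F≡ = begin
        Fp S (g ∷ (γ ++ f ∷ δ))                         ≡⟨ Fp-++ g γ (f ∷ δ) ⟩
        Fp S (g ∷ γ) ++ front f ++ fronts δ             ≡⟨ cong₂ (λ x y → x ++ y ++ fronts δ) (proj₂ ends) (trans (front-dist d-f) Fw≡) ⟩
        (Z ++ Bw (last⁺ g γ)) ++ (b ∷ w) ++ fronts δ     ≡⟨ ++-assoc Z _ _ ⟩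
        Z ++ Bw (last⁺ g γ) ++ (b ∷ w) ++ fronts δ       ≡⟨ cong (Z ++_) (++-assoc (Bw (last⁺ g γ)) [ b ] _) ⟨
        Z ++ (Bw (last⁺ g γ) ∷ʳ b) ++ w ++ fronts δ      ∎

  leftSpecial : Recurrent W → ∀ {e s} → Sym e s → All (Collecting S ∘ src) s → LeftSpecial (Fp S (e ∷ s)) W
  leftSpecial rec sy-e@(_ , ce , _) colls with two-in-edges (proj₁ ce)
  ... | e₁ , e₂ , e₁≢e₂ , t₁ , t₂ with back-distinct e₁ e₂ e₁≢e₂ (trans t₁ (sym t₂)) (subst (Collecting S) (sym t₁) ce)
  ...   | a₁ , a₂ , l₁ , l₂ , a₁≢a₂ =
          a₁ , a₂ , a₁≢a₂ , left-extension rec sy-e colls t₁ l₁ , left-extension rec sy-e colls t₂ l₂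

  support-bispecial : Recurrent W → ∀ {en} → Support S en → Bispecial (Bw en) W
  support-bispecial rec {en} sp@(c , d) =
    subst (λ w → LeftSpecial w W) (F≡B sy) (leftSpecial rec sy []) , rightSpecial
    where
      sy : Sym en []
      sy = sym-intro tt c d
      rightSpecial : RightSpecial (Bw en) W
      rightSpecial with two-out-edges (proj₂ d)
      ... | f₁ , f₂ , f₁≢f₂ , s₁ , s₂ with front-distinct f₁ f₂ f₁≢f₂ (trans s₁ (sym s₂)) (subst (Distributing S) (sym s₁) d)
      ...   | b₁ , b₂ , l₁ , l₂ , b₁≢b₂ =
              b₁ , b₂ , b₁≢b₂ , right-extension rec sp s₁ l₁ , right-extension rec sp s₂ l₂

lemma12 : {A : Set} (W : InfWord A) (S : GraphWithWords A) (M : ℕ) →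
    Recurrent W → IsRauzyScheme S W → IsScale S M →
    ∀ v → Collecting S v →
    ∀ e → GraphWithWords.src S e ≡ v →
    ∀ s → NaturalRightExt S (e ∷ []) s →
    LeftSpecial (Fp S s) W ×
    ∃[ u ] (EndsWith (Fp S s) u × Bispecial u W × M ≤ length u)
lemma12 W S M rec RS (_ , M≤support) v c-e e refl (_ ∷ s) ext@(path , (_ , refl) , d-end , _) =
  leftSpecial rec sy colls ,
  Bw en , F-endsWith-Bw-last sy , support-bispecial rec support , proj₂ (M≤support en support)
  where
    open GraphWithWords S
    open Graph S
    open Scheme RS
    colls : All (Collecting S ∘ src) s
    colls = naturalRightExt-collecting (IsRauzyScheme.graphWithWords RS) ext
    sy : Sym e s
    sy = path , c-e , d-end
    en = last⁺ e s
    support : Support S en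
    support = All-last⁺ {P = Collecting S ∘ src} (c-e ∷ colls) , sym-end sy
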